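{- Let $\theta_1=\{\langle x_1,M_1,\alpha_1\rangle,\dots,\langle x_n,M_n,\alpha_n\rangle\}$ be a substitution and $\theta_2=\{\langle y_1,N_1,\beta_1\rangle,\dots,\langle y_m,N_m,\beta_m\rangle\}$ a substitution where $y_1,\dots,y_m$ are distinct from $x_1,\dots,x_n$ and do not appear free in $M_1,\dots,M_n$. Suppose that for each $i$, $1\le i\le m$, there is a term $N_i'$ such that $\theta_1(N_i)\rightsquigarrow N_i'$ is derivable, and let $\theta_3=\{\langle y_1,N_1',\beta_1\rangle,\dots,\langle y_m,N_m',\beta_m\rangle\}$. Then for every kind, canonical type or canonical term $E$ and every $E_1$, $E_2$ such that $\theta_1(E)\rightsquigarrow E_1$ and $\theta_2(E)\rightsquigarrow E_2$ are derivable, there is an $E'$ such that $\theta_1(E_2)\rightsquigarrow E'$ and $\theta_3(E_1)\rightsquigarrow E'$ are derivable.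
   Context: Canonical LF syntax: kinds $K ::= \mathrm{Type}\mid \Pi x{:}A.K$; canonical types $A ::= P \mid \Pi x{:}A_1.A_2$; atomic types $P ::= a\mid P\,M$; canonical terms $M ::= R\mid \lambda x.M$; atomic terms $R ::= c\mid x\mid R\,M$ ($c$ term constants, $a$ type constants, $x$ variables; identification up to renaming of bound variables). Arity types: $\alpha ::= o\mid \alpha\to\alpha$. A substitution $\theta$ is a finite set $\{\langle x_i,M_i,\alpha_i\rangle\}$ with distinct variables $x_i$, canonical terms $M_i$, arity types $\alpha_i$; $\mathrm{dom}(\theta)=\{x_i\}$, $\mathrm{rng}(\theta)=\{M_i\}$. Hereditary substitution judgements $\theta(M)\rightsquigarrow M'$, $\theta(R)\rightsquigarrow_r R'$, $\theta(R)\rightsquigarrow_r M':\alpha'$ are defined inductively by: if $\theta(R)\rightsquigarrow_r R'$ then $\theta(R)\rightsquigarrow R'$; if $\theta(R)\rightsquigarrow_r M':\alpha'$ then $\theta(R)\rightsquigarrow M'$; $\theta(\lambda x.M)\rightsquigarrow\lambda x.M'$ if $x\notin\mathrm{dom}(\theta)$, $x$ not free in $\mathrm{rng}(\theta)$, and $\theta(M)\rightsquigarrow M'$; $\theta(x)\rightsquigarrow_r M:\alpha$ if $\langle x,M,\alpha\rangle\in\theta$; $\theta(R\,M)\rightsquigarrow_r M''':\alpha''$ if $\theta(R)\rightsquigarrow_r\lambda x.M':\alpha'\to\alpha''$, $\theta(M)\rightsquigarrow M''$, $\{\langle x,M'',\alpha'\rangle\}(M')\rightsquigarrow M'''$; $\theta(c)\rightsquigarrow_r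 c$; $\theta(x)\rightsquigarrow_r x$ if $x\notin\mathrm{dom}(\theta)$; $\theta(R\,M)\rightsquigarrow_r R'\,M'$ if $\theta(R)\rightsquigarrow_r R'$ and $\theta(M)\rightsquigarrow M'$. On types and kinds the substitution distributes to the terms: $\theta(a)\rightsquigarrow a$, $\theta(P\,M)\rightsquigarrow P'\,M'$ when the components substitute, $\theta(\Pi x{:}A_1.A_2)\rightsquigarrow\Pi x{:}A_1'.A_2'$ when $x$ is not in $\mathrm{dom}(\theta)$ nor free in $\mathrm{rng}(\theta)$ and the components substitute, $\theta(\mathrm{Type})\rightsquigarrow\mathrm{Type}$, and similarly for $\Pi x{:}A.K$. -}

module Defs where

open import Data.Nat using (ℕ)
open import Data.Product using (_×_; _,_; proj₁; proj₂; ∃-syntax)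
open import Data.List using (List; []; _∷_; map)
open import Data.List.Membership.Propositional using (_∈_)
open import Data.List.Relation.Unary.Any using (Any)
open import Data.List.Relation.Unary.Unique.Propositional using (Unique)
open import Data.List.Relation.Binary.Pointwise using (Pointwise)
open import Relation.Binary.PropositionalEquality using (_≡_; _≢_)
open import Relation.Nullary using (¬_)

-- Raw named syntax of canonical LF.
-- Variables, term constants and type constants are labelled by ℕ.

Var : Set
Var = ℕ

mutual
  data Can : Set where
    at  : Atm → Can
    lam : Var → Can → Can

  data Atm : Set where
    con : ℕ → Atm
    var : Var → Atm
    app : Atm → Can → Atm

data ATy : Set where
  tcon : ℕ → ATy
  tapp : ATy → Can → ATy

data Ty : Set where
  base : ATy → Ty
  pi   : Var → Ty → Ty → Ty

data Kind : Set where
  type : Kind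
  kpi  : Var → Ty → Kind → Kind

data Arity : Set where
  o   : Arity
  _⇒_ : Arity → Arity → Arity

-- α-equivalence (identification up to renaming of bound variables),
-- via the standard context-of-bound-variable-pairs definition.

Ctx : Set
Ctx = List (Var × Var)

data VarRel : Ctx → Var → Var → Set where
  vfree  : ∀ {x} → VarRel [] x x
  vhere  : ∀ {Γ x y} → VarRel ((x , y) ∷ Γ) x y
  vthere : ∀ {Γ x y x' y'} → x ≢ x' → y ≢ y' → VarRel Γ x y →
           VarRel ((x' , y') ∷ Γ) x y

mutual
  data CanA : Ctx → Can → Can → Set where
    at  : ∀ {Γ R R'} → AtmA Γ R R' → CanA Γ (at R) (at R')
    lam : ∀ {Γ x y M N} → CanA ((x , y) ∷ Γ) M N → CanA Γ (lam x M) (lam y N)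

  data AtmA : Ctx → Atm → Atm → Set where
    con : ∀ {Γ c} → AtmA Γ (con c) (con c)
    var : ∀ {Γ x y} → VarRel Γ x y → AtmA Γ (var x) (var y)
    app : ∀ {Γ R R' M M'} → AtmA Γ R R' → CanA Γ M M' → AtmA Γ (app R M) (app R' M')

data ATyA : Ctx → ATy → ATy → Set where
  tcon : ∀ {Γ a} → ATyA Γ (tcon a) (tcon a)
  tapp : ∀ {Γ P P' M M'} → ATyA Γ P P' → CanA Γ M M' → ATyA Γ (tapp P M) (tapp P' M')

data TyA : Ctx → Ty → Ty → Set where
  base : ∀ {Γ P P'} → ATyA Γ P P' → TyA Γ (base P) (base P')
  pi   : ∀ {Γ x y A A' B B'} → TyA Γ A A' → TyA ((x , y) ∷ Γ) B B' →
         TyA Γ (pi x A B) (pi y A' B')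

data KindA : Ctx → Kind → Kind → Set where
  type : ∀ {Γ} → KindA Γ type type
  kpi  : ∀ {Γ x y A A' K K'} → TyA Γ A A' → KindA ((x , y) ∷ Γ) K K' →
         KindA Γ (kpi x A K) (kpi y A' K')

_≡αc_ : Can → Can → Set
M ≡αc N = CanA [] M N

_≡αr_ : Atm → Atm → Set
R ≡αr S = AtmA [] R S

_≡αp_ : ATy → ATy → Set
P ≡αp Q = ATyA [] P Q

_≡αt_ : Ty → Ty → Set
A ≡αt B = TyA [] A B

_≡αk_ : Kind → Kind → Set
K ≡αk L = KindA [] K L

mutual
  data FreeC (x : Var) : Can → Set where
    at  : ∀ {R} → FreeA x R → FreeC x (at R)
    lam : ∀ {y M} → x ≢ y → FreeC x M → FreeC x (lam y M)

  data FreeA (x : Var) : Atm → Set where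
    var  : FreeA x (var x)
    appl : ∀ {R M} → FreeA x R → FreeA x (app R M)
    appr : ∀ {R M} → FreeC x M → FreeA x (app R M)

Entry : Set
Entry = Var × Can × Arity

Subst : Set
Subst = List Entry

var-of : Entry → Var
var-of = proj₁

IsSubst : Subst → Set
IsSubst θ = Unique (map var-of θ)

InDom : Var → Subst → Set
InDom x θ = Any (λ e → proj₁ e ≡ x) θ

NotFreeInRng : Var → Subst → Set
NotFreeInRng x θ = ∀ {y M α} → (y , M , α) ∈ θ → ¬ FreeC x M

-- Hereditary substitution judgements (exactly the rules of the paper),
-- on raw syntax, closed under α-equivalence of the subject and result
-- (so that derivability is derivability on α-equivalence classes).

mutual
  data HS (θ : Subst) : Can → Can → Set where
    hs-r   : ∀ {R R'} → HSr θ R R' → HS θ (at R) (at R')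
    hs-rc  : ∀ {R M' α'} → HSrc θ R M' α' → HS θ (at R) M'
    hs-lam : ∀ {x M M'} → ¬ InDom x θ → NotFreeInRng x θ → HS θ M M' →
             HS θ (lam x M) (lam x M')
    hs-α   : ∀ {M N N' M'} → M ≡αc N → HS θ N N' → N' ≡αc M' → HS θ M M'

  data HSrc (θ : Subst) : Atm → Can → Arity → Set where
    rc-var : ∀ {x M α} → (x , M , α) ∈ θ → HSrc θ (var x) M α
    rc-app : ∀ {R M x M' M'' M''' α' α''} →
             HSrc θ R (lam x M') (α' ⇒ α'') → HS θ M M'' →
             HS ((x , M'' , α') ∷ []) M' M''' →
             HSrc θ (app R M) M''' α''
    rc-α   : ∀ {R S N N' α} → R ≡αr S → HSrc θ S N α → N ≡αc N' → HSrc θ R N' α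

  data HSr (θ : Subst) : Atm → Atm → Set where
    r-con : ∀ {c} → HSr θ (con c) (con c)
    r-var : ∀ {x} → ¬ InDom x θ → HSr θ (var x) (var x)
    r-app : ∀ {R R' M M'} → HSr θ R R' → HS θ M M' → HSr θ (app R M) (app R' M')
    r-α   : ∀ {R S S' R'} → R ≡αr S → HSr θ S S' → S' ≡αr R' → HSr θ R R'

data HSp (θ : Subst) : ATy → ATy → Set where
  p-con : ∀ {a} → HSp θ (tcon a) (tcon a)
  p-app : ∀ {P P' M M'} → HSp θ P P' → HS θ M M' → HSp θ (tapp P M) (tapp P' M')
  p-α   : ∀ {P Q Q' P'} → P ≡αp Q → HSp θ Q Q' → Q' ≡αp P' → HSp θ P P'

data HSt (θ : Subst) : Ty → Ty → Set where
  t-base : ∀ {P P'} → HSp θ P P' → HSt θ (base P) (base P')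
  t-pi   : ∀ {x A1 A1' A2 A2'} → ¬ InDom x θ → NotFreeInRng x θ →
           HSt θ A1 A1' → HSt θ A2 A2' → HSt θ (pi x A1 A2) (pi x A1' A2')
  t-α    : ∀ {A B B' A'} → A ≡αt B → HSt θ B B' → B' ≡αt A' → HSt θ A A'

data HSk (θ : Subst) : Kind → Kind → Set where
  k-type : HSk θ type type
  k-pi   : ∀ {x A A' K K'} → ¬ InDom x θ → NotFreeInRng x θ →
           HSt θ A A' → HSk θ K K' → HSk θ (kpi x A K) (kpi x A' K')
  k-α    : ∀ {K L L' K'} → K ≡αk L → HSk θ L L' → L' ≡αk K' → HSk θ K K'

SubstUnder : Subst → Entry → Entry → Set
SubstUnder θ₁ (y , N , β) (y' , N' , β') = y ≡ y' × β ≡ β' × HS θ₁ N N'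

IsSubstitutedBy : Subst → Subst → Subst → Set
IsSubstitutedBy θ₁ θ₂ θ₃ = Pointwise (SubstUnder θ₁) θ₂ θ₃

-- Induction on the total size of the arity types of θ₁ and θ₂, and within that
-- on the size of E.  Every case is structural except the one where θ₂ replaces
-- the head variable of an application by some λz.Q : α → β and so contracts a
-- β-redex [P/z]Q, while θ₁ leaves the head in place.  Then the claim needed for
-- Q is the theorem itself for θ₁ and the single substitution {⟨z, P, α⟩},
-- whose arity α is strictly smaller than α → β, itself bounded by the arities
-- of θ₂.  In the symmetric case, where θ₁ contracts the redex, θ₃ takes the
-- place of θ₁; it has the same arities as θ₂, so the measure still decreases.
-- The judgements are closed under α-equivalence, so binders are renamed to a
-- variable fresh for all three substitutions, which requires knowing that
-- hereditary substitution respects α-equivalence.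

module Submission where

open import Data.Empty using (⊥; ⊥-elim)
open import Data.List using (List; []; _∷_; map; _++_)
open import Data.List.Membership.Propositional using (_∈_)
open import Data.List.Relation.Binary.Pointwise using ([]; _∷_)
open import Data.List.Relation.Unary.All using (All; []; _∷_)
open import Data.List.Relation.Unary.Any using (Any; here; there)
open import Data.Nat using (ℕ; suc; _≤_; _<_; _⊔_; _+_; s≤s; _≟_)
open import Data.Nat.Properties
  using (≤-refl; ≤-trans; ≤-pred; <-≤-trans; ≤-<-trans; <-irrefl; <⇒≢; n≤1+n; m≤m+n; m≤n+m;
         m≤m⊔n; m≤n⊔m; m⊔n<o⇒m<o; m⊔n<o⇒n<o; m+n≤o⇒m≤o; +-monoʳ-<; +-comm; +-identityʳ)
open import Data.Product using (_×_; _,_; proj₁; proj₂; swap; ∃-syntax)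
open import Data.Sum using (_⊎_; inj₁; inj₂)
import Data.Sum as Sum
open import Defs
open import Function using (_∘_)
open import Relation.Binary.PropositionalEquality
  using (_≡_; _≢_; refl; sym; cong; cong₂; subst)
open import Relation.Nullary using (¬_; Dec; yes; no)

-- α-equivalence

VarRel-[] : ∀ {x y} → VarRel [] x y → x ≡ y
VarRel-[] vfree = refl

idCtx : List Var → Ctx
idCtx = map (λ v → (v , v))

swapCtx : Ctx → Ctx
swapCtx = map swap

VarRel-refl : ∀ L x → VarRel (idCtx L) x x
VarRel-refl [] x = vfree
VarRel-refl (v ∷ L) x with x ≟ v
... | yes refl = vhere
... | no x≢v = vthere x≢v x≢v (VarRel-refl L x)

VarRel-sym : ∀ {Γ x y} → VarRel Γ x y → VarRel (swapCtx Γ) y x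
VarRel-sym vfree = vfree
VarRel-sym vhere = vhere
VarRel-sym (vthere x≢x' y≢y' r) = vthere y≢y' x≢x' (VarRel-sym r)

-- Position-wise relational composition; the empty context relates every
-- free variable to itself and so is a unit on either side.
data Composite : Ctx → Ctx → Ctx → Set where
  nilˡ : ∀ {Γ} → Composite [] Γ Γ
  nilʳ : ∀ {Γ} → Composite Γ [] Γ
  cons : ∀ {a b c Γ Δ Θ} → Composite Γ Δ Θ →
         Composite ((a , b) ∷ Γ) ((b , c) ∷ Δ) ((a , c) ∷ Θ)

VarRel-trans : ∀ {Γ Δ Θ x y z} → Composite Γ Δ Θ → VarRel Γ x y → VarRel Δ y z → VarRel Θ x z
VarRel-trans nilˡ r s with VarRel-[] r
... | refl = s
VarRel-trans nilʳ r s with VarRel-[] s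
... | refl = r
VarRel-trans (cons c) vhere vhere = vhere
VarRel-trans (cons c) vhere (vthere y≢y _ _) = ⊥-elim (y≢y refl)
VarRel-trans (cons c) (vthere _ y≢y _) vhere = ⊥-elim (y≢y refl)
VarRel-trans (cons c) (vthere x≢ _ r) (vthere _ z≢ s) = vthere x≢ z≢ (VarRel-trans c r s)

mutual
  CanA-refl : ∀ L M → CanA (idCtx L) M M
  CanA-refl L (at R) = at (AtmA-refl L R)
  CanA-refl L (lam x M) = lam (CanA-refl (x ∷ L) M)

  AtmA-refl : ∀ L R → AtmA (idCtx L) R R
  AtmA-refl L (con c) = con
  AtmA-refl L (var x) = var (VarRel-refl L x)
  AtmA-refl L (app R M) = app (AtmA-refl L R) (CanA-refl L M)

ATyA-refl : ∀ L P → ATyA (idCtx L) P P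
ATyA-refl L (tcon a) = tcon
ATyA-refl L (tapp P M) = tapp (ATyA-refl L P) (CanA-refl L M)

TyA-refl : ∀ L A → TyA (idCtx L) A A
TyA-refl L (base P) = base (ATyA-refl L P)
TyA-refl L (pi x A B) = pi (TyA-refl L A) (TyA-refl (x ∷ L) B)

KindA-refl : ∀ L K → KindA (idCtx L) K K
KindA-refl L type = type
KindA-refl L (kpi x A K) = kpi (TyA-refl L A) (KindA-refl (x ∷ L) K)

mutual
  CanA-sym : ∀ {Γ M N} → CanA Γ M N → CanA (swapCtx Γ) N M
  CanA-sym (at r) = at (AtmA-sym r)
  CanA-sym (lam m) = lam (CanA-sym m)

  AtmA-sym : ∀ {Γ R S} → AtmA Γ R S → AtmA (swapCtx Γ) S R
  AtmA-sym con = con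
  AtmA-sym (var r) = var (VarRel-sym r)
  AtmA-sym (app r m) = app (AtmA-sym r) (CanA-sym m)

ATyA-sym : ∀ {Γ P Q} → ATyA Γ P Q → ATyA (swapCtx Γ) Q P
ATyA-sym tcon = tcon
ATyA-sym (tapp p m) = tapp (ATyA-sym p) (CanA-sym m)

TyA-sym : ∀ {Γ A B} → TyA Γ A B → TyA (swapCtx Γ) B A
TyA-sym (base p) = base (ATyA-sym p)
TyA-sym (pi a b) = pi (TyA-sym a) (TyA-sym b)

KindA-sym : ∀ {Γ K L} → KindA Γ K L → KindA (swapCtx Γ) L K
KindA-sym type = type
KindA-sym (kpi a k) = kpi (TyA-sym a) (KindA-sym k)

mutual
  CanA-trans : ∀ {Γ Δ Θ M N O} → Composite Γ Δ Θ → CanA Γ M N → CanA Δ N O → CanA Θ M O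
  CanA-trans c (at r) (at s) = at (AtmA-trans c r s)
  CanA-trans c (lam m) (lam n) = lam (CanA-trans (cons c) m n)

  AtmA-trans : ∀ {Γ Δ Θ R S T} → Composite Γ Δ Θ → AtmA Γ R S → AtmA Δ S T → AtmA Θ R T
  AtmA-trans c con con = con
  AtmA-trans c (var r) (var s) = var (VarRel-trans c r s)
  AtmA-trans c (app r m) (app s n) = app (AtmA-trans c r s) (CanA-trans c m n)

ATyA-trans : ∀ {Γ Δ Θ P Q S} → Composite Γ Δ Θ → ATyA Γ P Q → ATyA Δ Q S → ATyA Θ P S
ATyA-trans c tcon tcon = tcon
ATyA-trans c (tapp p m) (tapp q n) = tapp (ATyA-trans c p q) (CanA-trans c m n)

TyA-trans : ∀ {Γ Δ Θ A B C} → Composite Γ Δ Θ → TyA Γ A B → TyA Δ B C → TyA Θ A C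
TyA-trans c (base p) (base q) = base (ATyA-trans c p q)
TyA-trans c (pi a b) (pi a' b') = pi (TyA-trans c a a') (TyA-trans (cons c) b b')

KindA-trans : ∀ {Γ Δ Θ K L J} → Composite Γ Δ Θ → KindA Γ K L → KindA Δ L J → KindA Θ K J
KindA-trans c type type = type
KindA-trans c (kpi a k) (kpi a' k') = kpi (TyA-trans c a a') (KindA-trans (cons c) k k')

≡αc-refl : ∀ {M} → M ≡αc M
≡αc-refl {M} = CanA-refl [] M

≡αr-refl : ∀ {R} → R ≡αr R
≡αr-refl {R} = AtmA-refl [] R

≡αp-refl : ∀ {P} → P ≡αp P
≡αp-refl {P} = ATyA-refl [] P

≡αt-refl : ∀ {A} → A ≡αt A
≡αt-refl {A} = TyA-refl [] A

≡αk-refl : ∀ {K} → K ≡αk K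
≡αk-refl {K} = KindA-refl [] K

≡αc-sym : ∀ {M N} → M ≡αc N → N ≡αc M
≡αc-sym = CanA-sym

≡αr-sym : ∀ {R S} → R ≡αr S → S ≡αr R
≡αr-sym = AtmA-sym

≡αp-sym : ∀ {P Q} → P ≡αp Q → Q ≡αp P
≡αp-sym = ATyA-sym

≡αt-sym : ∀ {A B} → A ≡αt B → B ≡αt A
≡αt-sym = TyA-sym

≡αk-sym : ∀ {K L} → K ≡αk L → L ≡αk K
≡αk-sym = KindA-sym

CanA-≡αˡ : ∀ {Γ M N O} → M ≡αc N → CanA Γ N O → CanA Γ M O
CanA-≡αˡ = CanA-trans nilˡ

CanA-≡αʳ : ∀ {Γ M N O} → CanA Γ M N → N ≡αc O → CanA Γ M O
CanA-≡αʳ = CanA-trans nilʳ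

AtmA-≡αˡ : ∀ {Γ R S T} → R ≡αr S → AtmA Γ S T → AtmA Γ R T
AtmA-≡αˡ = AtmA-trans nilˡ

AtmA-≡αʳ : ∀ {Γ R S T} → AtmA Γ R S → S ≡αr T → AtmA Γ R T
AtmA-≡αʳ = AtmA-trans nilʳ

ATyA-≡αˡ : ∀ {Γ P Q S} → P ≡αp Q → ATyA Γ Q S → ATyA Γ P S
ATyA-≡αˡ = ATyA-trans nilˡ

ATyA-≡αʳ : ∀ {Γ P Q S} → ATyA Γ P Q → Q ≡αp S → ATyA Γ P S
ATyA-≡αʳ = ATyA-trans nilʳ

TyA-≡αˡ : ∀ {Γ A B C} → A ≡αt B → TyA Γ B C → TyA Γ A C
TyA-≡αˡ = TyA-trans nilˡ

TyA-≡αʳ : ∀ {Γ A B C} → TyA Γ A B → B ≡αt C → TyA Γ A C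
TyA-≡αʳ = TyA-trans nilʳ

KindA-≡αˡ : ∀ {Γ K L J} → K ≡αk L → KindA Γ L J → KindA Γ K J
KindA-≡αˡ = KindA-trans nilˡ

KindA-≡αʳ : ∀ {Γ K L J} → KindA Γ K L → L ≡αk J → KindA Γ K J
KindA-≡αʳ = KindA-trans nilʳ

HS-≡αˡ : ∀ {θ M M' N} → M ≡αc M' → HS θ M N → HS θ M' N
HS-≡αˡ e d = hs-α (≡αc-sym e) d ≡αc-refl

HSr-≡αˡ : ∀ {θ R R' S} → R ≡αr R' → HSr θ R S → HSr θ R' S
HSr-≡αˡ e d = r-α (≡αr-sym e) d ≡αr-refl

HSrc-≡αˡ : ∀ {θ R R' N α} → R ≡αr R' → HSrc θ R N α → HSrc θ R' N α
HSrc-≡αˡ e d = rc-α (≡αr-sym e) d ≡αc-refl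

HSp-≡αˡ : ∀ {θ P P' Q} → P ≡αp P' → HSp θ P Q → HSp θ P' Q
HSp-≡αˡ e d = p-α (≡αp-sym e) d ≡αp-refl

HSt-≡αˡ : ∀ {θ A A' B} → A ≡αt A' → HSt θ A B → HSt θ A' B
HSt-≡αˡ e d = t-α (≡αt-sym e) d ≡αt-refl

HSk-≡αˡ : ∀ {θ K K' L} → K ≡αk K' → HSk θ K L → HSk θ K' L
HSk-≡αˡ e d = k-α (≡αk-sym e) d ≡αk-refl

-- Sizes, variable bounds and renaming

mutual
  sizeC : Can → ℕ
  sizeC (at R) = suc (sizeA R)
  sizeC (lam x M) = suc (sizeC M)

  sizeA : Atm → ℕ
  sizeA (con c) = 1
  sizeA (var x) = 1
  sizeA (app R M) = suc (sizeA R + sizeC M)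

sizeP : ATy → ℕ
sizeP (tcon a) = 1
sizeP (tapp P M) = suc (sizeP P + sizeC M)

sizeT : Ty → ℕ
sizeT (base P) = suc (sizeP P)
sizeT (pi x A B) = suc (sizeT A + sizeT B)

sizeK : Kind → ℕ
sizeK type = 1
sizeK (kpi x A K) = suc (sizeT A + sizeK K)

mutual
  CanA-size : ∀ {Γ M N} → CanA Γ M N → sizeC M ≡ sizeC N
  CanA-size (at r) = cong suc (AtmA-size r)
  CanA-size (lam m) = cong suc (CanA-size m)

  AtmA-size : ∀ {Γ R S} → AtmA Γ R S → sizeA R ≡ sizeA S
  AtmA-size con = refl
  AtmA-size (var r) = refl
  AtmA-size (app r m) = cong suc (cong₂ _+_ (AtmA-size r) (CanA-size m))

ATyA-size : ∀ {Γ P Q} → ATyA Γ P Q → sizeP P ≡ sizeP Q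
ATyA-size tcon = refl
ATyA-size (tapp p m) = cong suc (cong₂ _+_ (ATyA-size p) (CanA-size m))

TyA-size : ∀ {Γ A B} → TyA Γ A B → sizeT A ≡ sizeT B
TyA-size (base p) = cong suc (ATyA-size p)
TyA-size (pi a b) = cong suc (cong₂ _+_ (TyA-size a) (TyA-size b))

KindA-size : ∀ {Γ K L} → KindA Γ K L → sizeK K ≡ sizeK L
KindA-size type = refl
KindA-size (kpi a k) = cong suc (cong₂ _+_ (TyA-size a) (KindA-size k))

mutual
  maxC : Can → ℕ
  maxC (at R) = maxA R
  maxC (lam x M) = x ⊔ maxC M

  maxA : Atm → ℕ
  maxA (con c) = 0
  maxA (var x) = x
  maxA (app R M) = maxA R ⊔ maxC M

maxP : ATy → ℕ
maxP (tcon a) = 0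
maxP (tapp P M) = maxP P ⊔ maxC M

maxT : Ty → ℕ
maxT (base P) = maxP P
maxT (pi x A B) = x ⊔ (maxT A ⊔ maxT B)

maxK : Kind → ℕ
maxK type = 0
maxK (kpi x A K) = x ⊔ (maxT A ⊔ maxK K)

maxS : Subst → ℕ
maxS [] = 0
maxS ((x , M , α) ∷ θ) = x ⊔ (maxC M ⊔ maxS θ)

mutual
  FreeC⇒≤maxC : ∀ {u M} → FreeC u M → u ≤ maxC M
  FreeC⇒≤maxC (at f) = FreeA⇒≤maxA f
  FreeC⇒≤maxC {M = lam x M} (lam _ f) = ≤-trans (FreeC⇒≤maxC f) (m≤n⊔m x (maxC M))

  FreeA⇒≤maxA : ∀ {u R} → FreeA u R → u ≤ maxA R
  FreeA⇒≤maxA var = ≤-refl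
  FreeA⇒≤maxA {R = app R M} (appl f) = ≤-trans (FreeA⇒≤maxA f) (m≤m⊔n (maxA R) (maxC M))
  FreeA⇒≤maxA {R = app R M} (appr f) = ≤-trans (FreeC⇒≤maxC f) (m≤n⊔m (maxA R) (maxC M))

maxC<⇒¬FreeC : ∀ {w M} → maxC M < w → ¬ FreeC w M
maxC<⇒¬FreeC h f = <-irrefl refl (≤-<-trans (FreeC⇒≤maxC f) h)

maxS<⇒¬InDom : ∀ {w θ} → maxS θ < w → ¬ InDom w θ
maxS<⇒¬InDom {θ = (x , M , α) ∷ θ} h (here refl) = <-irrefl refl (m⊔n<o⇒m<o x _ h)
maxS<⇒¬InDom {θ = (x , M , α) ∷ θ} h (there d) =
  maxS<⇒¬InDom (m⊔n<o⇒n<o (maxC M) _ (m⊔n<o⇒n<o x _ h)) d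

maxS<⇒NotFreeInRng : ∀ {w θ} → maxS θ < w → NotFreeInRng w θ
maxS<⇒NotFreeInRng {θ = (x , M , α) ∷ θ} h (here refl) =
  maxC<⇒¬FreeC (m⊔n<o⇒m<o (maxC M) _ (m⊔n<o⇒n<o x _ h))
maxS<⇒NotFreeInRng {θ = (x , M , α) ∷ θ} h (there m) =
  maxS<⇒NotFreeInRng (m⊔n<o⇒n<o (maxC M) _ (m⊔n<o⇒n<o x _ h)) m

hs-lam-fresh : ∀ {θ w M M'} → maxS θ < w → HS θ M M' → HS θ (lam w M) (lam w M')
hs-lam-fresh w-fresh = hs-lam (maxS<⇒¬InDom w-fresh) (maxS<⇒NotFreeInRng w-fresh)

t-pi-fresh : ∀ {θ w A A' B B'} → maxS θ < w → HSt θ A A' → HSt θ B B' →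
             HSt θ (pi w A B) (pi w A' B')
t-pi-fresh w-fresh = t-pi (maxS<⇒¬InDom w-fresh) (maxS<⇒NotFreeInRng w-fresh)

k-pi-fresh : ∀ {θ w A A' K K'} → maxS θ < w → HSt θ A A' → HSk θ K K' →
             HSk θ (kpi w A K) (kpi w A' K')
k-pi-fresh w-fresh = k-pi (maxS<⇒¬InDom w-fresh) (maxS<⇒NotFreeInRng w-fresh)

∈⇒maxC≤maxS : ∀ {x M α θ} → (x , M , α) ∈ θ → maxC M ≤ maxS θ
∈⇒maxC≤maxS {x} {M} (here refl) = ≤-trans (m≤m⊔n (maxC M) _) (m≤n⊔m x _)
∈⇒maxC≤maxS {θ = (y , N , β) ∷ θ} (there m) =
  ≤-trans (∈⇒maxC≤maxS m) (≤-trans (m≤n⊔m (maxC N) _) (m≤n⊔m y _))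

fresh : Subst → ℕ → Var
fresh θ k = suc (maxS θ ⊔ k)

maxS<fresh : ∀ θ k → maxS θ < fresh θ k
maxS<fresh θ k = s≤s (m≤m⊔n _ _)

<fresh : ∀ θ k → k < fresh θ k
<fresh θ k = s≤s (m≤n⊔m _ _)

ren : Var → Var → Var → Var
ren a b v with v ≟ a
... | yes _ = b
... | no _ = v

ren-injective : ∀ {a b u v} → u ≢ b → v ≢ b → u ≢ v → ren a b u ≢ ren a b v
ren-injective {a} {b} {u} {v} u≢b v≢b u≢v e with u ≟ a | v ≟ a
... | yes refl | yes refl = u≢v refl
... | yes refl | no _ = v≢b (sym e)
... | no _ | yes refl = u≢b e
... | no _ | no _ = u≢v e

mutual
  renC : Var → Var → Can → Can
  renC a b (at R) = at (renA a b R)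
  renC a b (lam x M) = lam (ren a b x) (renC a b M)

  renA : Var → Var → Atm → Atm
  renA a b (con c) = con c
  renA a b (var x) = var (ren a b x)
  renA a b (app R M) = app (renA a b R) (renC a b M)

renP : Var → Var → ATy → ATy
renP a b (tcon c) = tcon c
renP a b (tapp P M) = tapp (renP a b P) (renC a b M)

renT : Var → Var → Ty → Ty
renT a b (base P) = base (renP a b P)
renT a b (pi x A B) = pi (ren a b x) (renT a b A) (renT a b B)

renK : Var → Var → Kind → Kind
renK a b type = type
renK a b (kpi x A K) = kpi (ren a b x) (renT a b A) (renK a b K)

renCtx : Var → Var → List Var → Ctx
renCtx a b L = map (λ v → (v , ren a b v)) L ++ (a , b) ∷ []

VarRel-ren : ∀ {a b} L u → All (_< b) L → u < b → VarRel (renCtx a b L) u (ren a b u)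
VarRel-ren {a} {b} [] u [] u<b with u ≟ a
... | yes refl = vhere
... | no u≢a = vthere u≢a (<⇒≢ u<b) vfree
VarRel-ren {a} {b} (v ∷ L) u (v<b ∷ L<b) u<b with u ≟ v
... | yes refl = vhere
... | no u≢v = vthere u≢v (ren-injective (<⇒≢ u<b) (<⇒≢ v<b) u≢v) (VarRel-ren L u L<b u<b)

mutual
  CanA-ren : ∀ {a b} L M → All (_< b) L → maxC M < b → CanA (renCtx a b L) M (renC a b M)
  CanA-ren L (at R) L<b h = at (AtmA-ren L R L<b h)
  CanA-ren L (lam x M) L<b h = lam (CanA-ren (x ∷ L) M (m⊔n<o⇒m<o x _ h ∷ L<b) (m⊔n<o⇒n<o x _ h))

  AtmA-ren : ∀ {a b} L R → All (_< b) L → maxA R < b → AtmA (renCtx a b L) R (renA a b R)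
  AtmA-ren L (con c) L<b h = con
  AtmA-ren L (var x) L<b h = var (VarRel-ren L x L<b h)
  AtmA-ren L (app R M) L<b h =
    app (AtmA-ren L R L<b (m⊔n<o⇒m<o (maxA R) _ h)) (CanA-ren L M L<b (m⊔n<o⇒n<o (maxA R) _ h))

ATyA-ren : ∀ {a b} L P → All (_< b) L → maxP P < b → ATyA (renCtx a b L) P (renP a b P)
ATyA-ren L (tcon c) L<b h = tcon
ATyA-ren L (tapp P M) L<b h =
  tapp (ATyA-ren L P L<b (m⊔n<o⇒m<o (maxP P) _ h)) (CanA-ren L M L<b (m⊔n<o⇒n<o (maxP P) _ h))

TyA-ren : ∀ {a b} L A → All (_< b) L → maxT A < b → TyA (renCtx a b L) A (renT a b A)
TyA-ren L (base P) L<b h = base (ATyA-ren L P L<b h)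
TyA-ren {b = b} L (pi x A B) L<b h =
  pi (TyA-ren L A L<b (m⊔n<o⇒m<o (maxT A) _ h'))
     (TyA-ren (x ∷ L) B (m⊔n<o⇒m<o x _ h ∷ L<b) (m⊔n<o⇒n<o (maxT A) _ h'))
  where
  h' : maxT A ⊔ maxT B < b
  h' = m⊔n<o⇒n<o x _ h

KindA-ren : ∀ {a b} L K → All (_< b) L → maxK K < b → KindA (renCtx a b L) K (renK a b K)
KindA-ren L type L<b h = type
KindA-ren {b = b} L (kpi x A K) L<b h =
  kpi (TyA-ren L A L<b (m⊔n<o⇒m<o (maxT A) _ h'))
      (KindA-ren (x ∷ L) K (m⊔n<o⇒m<o x _ h ∷ L<b) (m⊔n<o⇒n<o (maxT A) _ h'))
  where
  h' : maxT A ⊔ maxK K < b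
  h' = m⊔n<o⇒n<o x _ h

CanA-ren₀ : ∀ {a b} M → maxC M < b → CanA ((a , b) ∷ []) M (renC a b M)
CanA-ren₀ M = CanA-ren [] M []

TyA-ren₀ : ∀ {a b} A → maxT A < b → TyA ((a , b) ∷ []) A (renT a b A)
TyA-ren₀ A = TyA-ren [] A []

KindA-ren₀ : ∀ {a b} K → maxK K < b → KindA ((a , b) ∷ []) K (renK a b K)
KindA-ren₀ K = KindA-ren [] K []

-- Hereditary substitution respects α-equivalence

InLeft InRight : Var → Ctx → Set
InLeft u = Any ((u ≡_) ∘ proj₁)
InRight u = Any ((u ≡_) ∘ proj₂)

Any-tail⊎ : ∀ {A Q : Set} {P : A → Set} {p xs} → ¬ P p → Any P (p ∷ xs) ⊎ Q → Any P xs ⊎ Q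
Any-tail⊎ ¬Pp (inj₁ (here Pp)) = ⊥-elim (¬Pp Pp)
Any-tail⊎ ¬Pp (inj₁ (there i)) = inj₁ i
Any-tail⊎ ¬Pp (inj₂ q) = inj₂ q

Any-∷⊎ : ∀ {A Q : Set} {P : A → Set} {p xs} → Dec (P p) → (¬ P p → Any P xs ⊎ Q) →
         Any P (p ∷ xs) ⊎ Q
Any-∷⊎ (yes Pp) k = inj₁ (here Pp)
Any-∷⊎ (no ¬Pp) k = Sum.map₁ there (k ¬Pp)

VarRel-weaken : ∀ {Γ x w} Δ {u v} → VarRel (Δ ++ Γ) u v →
                InLeft u Δ ⊎ u ≢ x → InRight v Δ ⊎ v ≢ w →
                VarRel (Δ ++ (x , w) ∷ Γ) u v
VarRel-weaken [] r (inj₂ u≢x) (inj₂ v≢w) = vthere u≢x v≢w r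
VarRel-weaken (p ∷ Δ) vhere hu hv = vhere
VarRel-weaken (p ∷ Δ) (vthere u≢ v≢ r) hu hv =
  vthere u≢ v≢ (VarRel-weaken Δ r (Any-tail⊎ u≢ hu) (Any-tail⊎ v≢ hv))

mutual
  CanA-weaken : ∀ {Γ x w} Δ {M N} → CanA (Δ ++ Γ) M N →
                (∀ u → FreeC u M → InLeft u Δ ⊎ u ≢ x) →
                (∀ v → FreeC v N → InRight v Δ ⊎ v ≢ w) →
                CanA (Δ ++ (x , w) ∷ Γ) M N
  CanA-weaken Δ (at r) hM hN = at (AtmA-weaken Δ r (λ u → hM u ∘ at) (λ v → hN v ∘ at))
  CanA-weaken Δ (lam {x = a} {y = b} m) hM hN =
    lam (CanA-weaken ((a , b) ∷ Δ) m (λ u f → Any-∷⊎ (u ≟ a) (λ u≢a → hM u (lam u≢a f)))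
                                      (λ v f → Any-∷⊎ (v ≟ b) (λ v≢b → hN v (lam v≢b f))))

  AtmA-weaken : ∀ {Γ x w} Δ {R S} → AtmA (Δ ++ Γ) R S →
                (∀ u → FreeA u R → InLeft u Δ ⊎ u ≢ x) →
                (∀ v → FreeA v S → InRight v Δ ⊎ v ≢ w) →
                AtmA (Δ ++ (x , w) ∷ Γ) R S
  AtmA-weaken Δ con hR hS = con
  AtmA-weaken Δ (var r) hR hS = var (VarRel-weaken Δ r (hR _ var) (hS _ var))
  AtmA-weaken Δ (app r m) hR hS =
    app (AtmA-weaken Δ r (λ u → hR u ∘ appl) (λ v → hS v ∘ appl))
        (CanA-weaken Δ m (λ u → hR u ∘ appr) (λ v → hS v ∘ appr))

CanA-weaken₀ : ∀ {Γ x w M N} → CanA Γ M N → ¬ FreeC x M → ¬ FreeC w N → CanA ((x , w) ∷ Γ) M N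
CanA-weaken₀ m x∉M w∉N =
  CanA-weaken [] m (λ u f → inj₂ λ { refl → x∉M f }) (λ v f → inj₂ λ { refl → w∉N f })

mutual
  FreeC-transport : ∀ {Γ M N x} → CanA Γ M N → FreeC x M → ∃[ y ] (FreeC y N × VarRel Γ x y)
  FreeC-transport (at r) (at f) with FreeA-transport r f
  ... | y , g , v = y , at g , v
  FreeC-transport (lam m) (lam x≢ f) with FreeC-transport m f
  ... | y , g , vhere = ⊥-elim (x≢ refl)
  ... | y , g , vthere _ y≢ v = y , lam y≢ g , v

  FreeA-transport : ∀ {Γ R S x} → AtmA Γ R S → FreeA x R → ∃[ y ] (FreeA y S × VarRel Γ x y)
  FreeA-transport (var r) var = _ , var , r
  FreeA-transport (app r m) (appl f) with FreeA-transport r f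
  ... | y , g , v = y , appl g , v
  FreeA-transport (app r m) (appr f) with FreeC-transport m f
  ... | y , g , v = y , appr g , v

∈⇒InDom : ∀ {x M α θ} → (x , M , α) ∈ θ → InDom x θ
∈⇒InDom (here refl) = here refl
∈⇒InDom (there m) = there (∈⇒InDom m)

-- Γ pairs the variables of the subjects of θ and θ°, Γ' those of their results.
record SubstRel (θ θ° : Subst) (Γ Γ' : Ctx) : Set where
  field
    entry-rel   : ∀ {x x° M α} → VarRel Γ x x° → (x , M , α) ∈ θ →
                  ∃[ M° ] ((x° , M° , α) ∈ θ° × CanA Γ' M M°)
    outside-rel : ∀ {u v} → VarRel Γ u v → ¬ InDom u θ → ¬ InDom v θ° × VarRel Γ' u v
open SubstRel

SubstRel-id : ∀ {θ} → SubstRel θ θ [] []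
entry-rel SubstRel-id vfree m = _ , m , ≡αc-refl
outside-rel SubstRel-id vfree u∉θ = u∉θ , vfree

SubstRel-bind : ∀ {θ θ° Γ Γ' x w} → SubstRel θ θ° Γ Γ' →
                ¬ InDom x θ → NotFreeInRng x θ → maxS θ° < w →
                SubstRel θ θ° ((x , w) ∷ Γ) ((x , w) ∷ Γ')
entry-rel (SubstRel-bind H x∉θ _ _) vhere m = ⊥-elim (x∉θ (∈⇒InDom m))
entry-rel (SubstRel-bind H _ x∉rng w-fresh) (vthere _ _ r) m with entry-rel H r m
... | M° , m° , c =
  M° , m° , CanA-weaken₀ c (x∉rng m) (maxC<⇒¬FreeC (≤-<-trans (∈⇒maxC≤maxS m°) w-fresh))
outside-rel (SubstRel-bind H _ _ w-fresh) vhere _ = maxS<⇒¬InDom w-fresh , vhere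
outside-rel (SubstRel-bind H _ _ _) (vthere u≢ v≢ r) u∉θ with outside-rel H r u∉θ
... | v∉θ° , r' = v∉θ° , vthere u≢ v≢ r'

SubstRel-fresh : ∀ {θ x w} → ¬ InDom x θ → NotFreeInRng x θ → maxS θ < w →
                 SubstRel θ θ ((x , w) ∷ []) ((x , w) ∷ [])
SubstRel-fresh = SubstRel-bind SubstRel-id

SubstRel-single : ∀ {z z° P P° α Γ'} → CanA Γ' P P° →
                  SubstRel ((z , P , α) ∷ []) ((z° , P° , α) ∷ []) ((z , z°) ∷ Γ') Γ'
entry-rel (SubstRel-single p) vhere (here refl) = _ , here refl , p
entry-rel (SubstRel-single p) (vthere z≢z _ _) (here refl) = ⊥-elim (z≢z refl)
outside-rel (SubstRel-single p) vhere u∉ = ⊥-elim (u∉ (here refl))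
outside-rel (SubstRel-single p) (vthere _ v≢z° r) _ = (λ { (here e) → v≢z° (sym e) }) , r

-- Under a binder the θ°-side body is first renamed to a variable fresh for θ°,
-- so that the binder rule applies on that side.
mutual
  HS-transport : ∀ {θ θ° Γ Γ' M M° N} → SubstRel θ θ° Γ Γ' → CanA Γ M M° → HS θ M N →
                 ∃[ N° ] (HS θ° M° N° × CanA Γ' N N°)
  HS-transport H (at r) (hs-r d) with HSr-transport H r d
  ... | N° , d° , c = at N° , hs-r d° , at c
  HS-transport H (at r) (hs-rc d) with HSrc-transport H r d
  ... | N° , d° , c = N° , hs-rc d° , c
  HS-transport {θ° = θ°} H (lam {y = x°} {N = B°} m) (hs-lam x∉θ x∉rng d)
    with HS-transport (SubstRel-bind H x∉θ x∉rng (maxS<fresh θ° _))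
                      (CanA-trans (cons nilʳ) m (CanA-ren₀ B° (<fresh θ° _))) d
  ... | N₁ , d₁ , c =
    lam (fresh θ° (maxC B°)) N₁ ,
    hs-α (lam (CanA-ren₀ B° (<fresh θ° _))) (hs-lam-fresh (maxS<fresh θ° _) d₁) ≡αc-refl ,
    lam c
  HS-transport H m (hs-α e d e') with HS-transport H (CanA-≡αˡ (≡αc-sym e) m) d
  ... | N° , d° , c = N° , d° , CanA-≡αˡ (≡αc-sym e') c

  HSr-transport : ∀ {θ θ° Γ Γ' R R° S} → SubstRel θ θ° Γ Γ' → AtmA Γ R R° → HSr θ R S →
                  ∃[ S° ] (HSr θ° R° S° × AtmA Γ' S S°)
  HSr-transport H con r-con = _ , r-con , con
  HSr-transport H (var r) (r-var u∉θ) with outside-rel H r u∉θ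
  ... | v∉θ° , r' = _ , r-var v∉θ° , var r'
  HSr-transport H (app r m) (r-app d e) with HSr-transport H r d | HS-transport H m e
  ... | S₁ , d₁ , c₁ | N₁ , e₁ , c₂ = app S₁ N₁ , r-app d₁ e₁ , app c₁ c₂
  HSr-transport H r (r-α e d e') with HSr-transport H (AtmA-≡αˡ (≡αr-sym e) r) d
  ... | S° , d° , c = S° , d° , AtmA-≡αˡ (≡αr-sym e') c

  HSrc-transport : ∀ {θ θ° Γ Γ' R R° N α} → SubstRel θ θ° Γ Γ' → AtmA Γ R R° → HSrc θ R N α →
                   ∃[ N° ] (HSrc θ° R° N° α × CanA Γ' N N°)
  HSrc-transport H (var r) (rc-var m) with entry-rel H r m
  ... | M° , m° , c = M° , rc-var m° , c
  HSrc-transport H (app r m) (rc-app d e f) with HSrc-transport H r d | HS-transport H m e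
  ... | lam z° Q° , d₁ , lam q | P° , e₁ , p with HS-transport (SubstRel-single p) q f
  ... | N° , f₁ , c = N° , rc-app d₁ e₁ f₁ , c
  HSrc-transport H r (rc-α e d e') with HSrc-transport H (AtmA-≡αˡ (≡αr-sym e) r) d
  ... | N° , d° , c = N° , d° , CanA-≡αˡ (≡αc-sym e') c

HSp-transport : ∀ {θ θ° Γ Γ' P P° Q} → SubstRel θ θ° Γ Γ' → ATyA Γ P P° → HSp θ P Q →
                ∃[ Q° ] (HSp θ° P° Q° × ATyA Γ' Q Q°)
HSp-transport H tcon p-con = _ , p-con , tcon
HSp-transport H (tapp p m) (p-app d e) with HSp-transport H p d | HS-transport H m e
... | Q₁ , d₁ , c₁ | N₁ , e₁ , c₂ = tapp Q₁ N₁ , p-app d₁ e₁ , tapp c₁ c₂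
HSp-transport H p (p-α e d e') with HSp-transport H (ATyA-≡αˡ (≡αp-sym e) p) d
... | Q° , d° , c = Q° , d° , ATyA-≡αˡ (≡αp-sym e') c

HSt-transport : ∀ {θ θ° Γ Γ' A A° B} → SubstRel θ θ° Γ Γ' → TyA Γ A A° → HSt θ A B →
                ∃[ B° ] (HSt θ° A° B° × TyA Γ' B B°)
HSt-transport H (base p) (t-base d) with HSp-transport H p d
... | Q , d₁ , c = base Q , t-base d₁ , base c
HSt-transport {θ° = θ°} H (pi {y = x°} {B' = B°} a b) (t-pi x∉θ x∉rng d e)
  with HSt-transport H a d
     | HSt-transport (SubstRel-bind H x∉θ x∉rng (maxS<fresh θ° _))
                     (TyA-trans (cons nilʳ) b (TyA-ren₀ B° (<fresh θ° _))) e
... | A₁ , d₁ , c₁ | B₁ , e₁ , c₂ =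
  pi (fresh θ° (maxT B°)) A₁ B₁ ,
  t-α (pi ≡αt-refl (TyA-ren₀ B° (<fresh θ° _))) (t-pi-fresh (maxS<fresh θ° _) d₁ e₁) ≡αt-refl ,
  pi c₁ c₂
HSt-transport H a (t-α e d e') with HSt-transport H (TyA-≡αˡ (≡αt-sym e) a) d
... | B° , d° , c = B° , d° , TyA-≡αˡ (≡αt-sym e') c

HSk-transport : ∀ {θ θ° Γ Γ' K K° L} → SubstRel θ θ° Γ Γ' → KindA Γ K K° → HSk θ K L →
                ∃[ L° ] (HSk θ° K° L° × KindA Γ' L L°)
HSk-transport H type k-type = type , k-type , type
HSk-transport {θ° = θ°} H (kpi {y = x°} {K' = K°} a k) (k-pi x∉θ x∉rng d e)
  with HSt-transport H a d
     | HSk-transport (SubstRel-bind H x∉θ x∉rng (maxS<fresh θ° _))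
                     (KindA-trans (cons nilʳ) k (KindA-ren₀ K° (<fresh θ° _))) e
... | A₁ , d₁ , c₁ | K₁ , e₁ , c₂ =
  kpi (fresh θ° (maxK K°)) A₁ K₁ ,
  k-α (kpi ≡αt-refl (KindA-ren₀ K° (<fresh θ° _))) (k-pi-fresh (maxS<fresh θ° _) d₁ e₁) ≡αk-refl ,
  kpi c₁ c₂
HSk-transport H k (k-α e d e') with HSk-transport H (KindA-≡αˡ (≡αk-sym e) k) d
... | L° , d° , c = L° , d° , KindA-≡αˡ (≡αk-sym e') c

-- Inversion

HS-lam-inv : ∀ {θ x B N} → HS θ (lam x B) N →
  ∃[ x₁ ] ∃[ B₁ ] ∃[ C₁ ]
    (lam x B ≡αc lam x₁ B₁ × ¬ InDom x₁ θ × NotFreeInRng x₁ θ × HS θ B₁ C₁ × lam x₁ C₁ ≡αc N)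
HS-lam-inv (hs-lam x∉θ x∉rng d) = _ , _ , _ , ≡αc-refl , x∉θ , x∉rng , d , ≡αc-refl
HS-lam-inv (hs-α (lam b) d e) with HS-lam-inv d
... | x₁ , B₁ , C₁ , c , x∉θ , x∉rng , d₁ , c' =
  x₁ , B₁ , C₁ , CanA-≡αˡ (lam b) c , x∉θ , x∉rng , d₁ , CanA-≡αʳ c' e

HS-at-inv : ∀ {θ R N} → HS θ (at R) N →
  (∃[ R' ] (HSr θ R R' × at R' ≡αc N)) ⊎ (∃[ α ] HSrc θ R N α)
HS-at-inv (hs-r d) = inj₁ (_ , d , ≡αc-refl)
HS-at-inv (hs-rc d) = inj₂ (_ , d)
HS-at-inv (hs-α (at r) d e) with HS-at-inv d
... | inj₁ (R' , d' , c) = inj₁ (R' , r-α r d' ≡αr-refl , CanA-≡αʳ c e)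
... | inj₂ (α , d') = inj₂ (α , rc-α r d' e)

¬HSrc-con : ∀ {θ c N α} → ¬ HSrc θ (con c) N α
¬HSrc-con (rc-α con d e) = ¬HSrc-con d

HSrc-var-inv : ∀ {θ x N α} → HSrc θ (var x) N α → ∃[ M ] ((x , M , α) ∈ θ × M ≡αc N)
HSrc-var-inv (rc-var m) = _ , m , ≡αc-refl
HSrc-var-inv (rc-α (var r) d e) with VarRel-[] r
... | refl with HSrc-var-inv d
... | M , m , c = M , m , CanA-≡αʳ c e

HSrc-app-inv : ∀ {θ R M N α} → HSrc θ (app R M) N α →
  ∃[ z ] ∃[ Q ] ∃[ α' ] ∃[ P ] ∃[ N' ]
    (HSrc θ R (lam z Q) (α' ⇒ α) × HS θ M P × HS ((z , P , α') ∷ []) Q N' × N' ≡αc N)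
HSrc-app-inv (rc-app d e f) = _ , _ , _ , _ , _ , d , e , f , ≡αc-refl
HSrc-app-inv (rc-α (app r m) d e) with HSrc-app-inv d
... | z , Q , α' , P , N' , d₁ , e₁ , f₁ , c =
  z , Q , α' , P , N' , rc-α r d₁ ≡αc-refl , hs-α m e₁ ≡αc-refl , f₁ , CanA-≡αʳ c e

HSr-con-inv : ∀ {θ c R'} → HSr θ (con c) R' → con c ≡αr R'
HSr-con-inv r-con = con
HSr-con-inv (r-α con d e) = AtmA-≡αˡ (HSr-con-inv d) e

HSr-var-inv : ∀ {θ x R'} → HSr θ (var x) R' → ¬ InDom x θ × var x ≡αr R'
HSr-var-inv (r-var x∉θ) = x∉θ , ≡αr-refl
HSr-var-inv (r-α (var r) d e) with VarRel-[] r
... | refl with HSr-var-inv d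
... | x∉θ , c = x∉θ , AtmA-≡αʳ c e

HSr-app-inv : ∀ {θ R M R'} → HSr θ (app R M) R' →
  ∃[ R₁ ] ∃[ M₁ ] (HSr θ R R₁ × HS θ M M₁ × app R₁ M₁ ≡αr R')
HSr-app-inv (r-app d e) = _ , _ , d , e , ≡αr-refl
HSr-app-inv (r-α (app r m) d e) with HSr-app-inv d
... | R₁ , M₁ , d₁ , e₁ , c =
  R₁ , M₁ , r-α r d₁ ≡αr-refl , hs-α m e₁ ≡αc-refl , AtmA-≡αʳ c e

HSp-con-inv : ∀ {θ a Q} → HSp θ (tcon a) Q → tcon a ≡αp Q
HSp-con-inv p-con = tcon
HSp-con-inv (p-α tcon d e) = ATyA-≡αˡ (HSp-con-inv d) e

HSp-app-inv : ∀ {θ P M Q} → HSp θ (tapp P M) Q →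
  ∃[ P₁ ] ∃[ M₁ ] (HSp θ P P₁ × HS θ M M₁ × tapp P₁ M₁ ≡αp Q)
HSp-app-inv (p-app d e) = _ , _ , d , e , ≡αp-refl
HSp-app-inv (p-α (tapp p m) d e) with HSp-app-inv d
... | P₁ , M₁ , d₁ , e₁ , c =
  P₁ , M₁ , p-α p d₁ ≡αp-refl , hs-α m e₁ ≡αc-refl , ATyA-≡αʳ c e

HSt-base-inv : ∀ {θ P B} → HSt θ (base P) B → ∃[ P₁ ] (HSp θ P P₁ × base P₁ ≡αt B)
HSt-base-inv (t-base d) = _ , d , ≡αt-refl
HSt-base-inv (t-α (base p) d e) with HSt-base-inv d
... | P₁ , d₁ , c = P₁ , p-α p d₁ ≡αp-refl , TyA-≡αʳ c e

HSt-pi-inv : ∀ {θ x A B C} → HSt θ (pi x A B) C →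
  ∃[ x₁ ] ∃[ A₁ ] ∃[ B₁ ] ∃[ B₁' ]
    (TyA ((x , x₁) ∷ []) B B₁ × ¬ InDom x₁ θ × NotFreeInRng x₁ θ ×
     HSt θ A A₁ × HSt θ B₁ B₁' × pi x₁ A₁ B₁' ≡αt C)
HSt-pi-inv (t-pi x∉θ x∉rng d e) =
  _ , _ , _ , _ , TyA-refl (_ ∷ []) _ , x∉θ , x∉rng , d , e , ≡αt-refl
HSt-pi-inv (t-α (pi a b) d e) with HSt-pi-inv d
... | x₁ , A₁ , B₁ , B₁' , b₁ , x∉θ , x∉rng , d₁ , e₁ , c =
  x₁ , A₁ , B₁ , B₁' , TyA-trans (cons nilˡ) b b₁ , x∉θ , x∉rng , t-α a d₁ ≡αt-refl , e₁ , TyA-≡αʳ c e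

HSk-type-inv : ∀ {θ L} → HSk θ type L → type ≡αk L
HSk-type-inv k-type = type
HSk-type-inv (k-α type d e) = KindA-≡αˡ (HSk-type-inv d) e

HSk-pi-inv : ∀ {θ x A K L} → HSk θ (kpi x A K) L →
  ∃[ x₁ ] ∃[ A₁ ] ∃[ K₁ ] ∃[ K₁' ]
    (KindA ((x , x₁) ∷ []) K K₁ × ¬ InDom x₁ θ × NotFreeInRng x₁ θ ×
     HSt θ A A₁ × HSk θ K₁ K₁' × kpi x₁ A₁ K₁' ≡αk L)
HSk-pi-inv (k-pi x∉θ x∉rng d e) =
  _ , _ , _ , _ , KindA-refl (_ ∷ []) _ , x∉θ , x∉rng , d , e , ≡αk-refl
HSk-pi-inv (k-α (kpi a k) d e) with HSk-pi-inv d
... | x₁ , A₁ , K₁ , K₁' , k₁ , x∉θ , x∉rng , d₁ , e₁ , c =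
  x₁ , A₁ , K₁ , K₁' , KindA-trans (cons nilˡ) k k₁ , x∉θ , x∉rng , t-α a d₁ ≡αt-refl , e₁ , KindA-≡αʳ c e

HS-lam-inv-fresh : ∀ {θ x B N w} → HS θ (lam x B) N → maxS θ < w → maxC B < w →
  ∃[ C ] (HS θ (renC x w B) C × lam w C ≡αc N)
HS-lam-inv-fresh {B = B} d w-fresh w-above with HS-lam-inv d
... | x₁ , B₁ , C₁ , lam b₁ , x₁∉θ , x₁∉rng , e , c
  with HS-transport (SubstRel-fresh x₁∉θ x₁∉rng w-fresh)
                    (CanA-trans (cons nilˡ) (CanA-sym b₁) (CanA-ren₀ B w-above)) e
... | C , e° , c° = C , e° , CanA-≡αˡ (lam (CanA-sym c°)) c

HSt-pi-inv-fresh : ∀ {θ x A B C w} → HSt θ (pi x A B) C → maxS θ < w → maxT B < w →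
  ∃[ A₁ ] ∃[ B° ] (HSt θ A A₁ × HSt θ (renT x w B) B° × pi w A₁ B° ≡αt C)
HSt-pi-inv-fresh {B = B} d w-fresh w-above with HSt-pi-inv d
... | x₁ , A₁ , B₁ , B₁' , b₁ , x₁∉θ , x₁∉rng , a , e , c
  with HSt-transport (SubstRel-fresh x₁∉θ x₁∉rng w-fresh)
                     (TyA-trans (cons nilˡ) (TyA-sym b₁) (TyA-ren₀ B w-above)) e
... | B° , e° , c° = A₁ , B° , a , e° , TyA-≡αˡ (pi ≡αt-refl (TyA-sym c°)) c

HSk-pi-inv-fresh : ∀ {θ x A K L w} → HSk θ (kpi x A K) L → maxS θ < w → maxK K < w →
  ∃[ A₁ ] ∃[ K° ] (HSt θ A A₁ × HSk θ (renK x w K) K° × kpi w A₁ K° ≡αk L)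
HSk-pi-inv-fresh {K = K} d w-fresh w-above with HSk-pi-inv d
... | x₁ , A₁ , K₁ , K₁' , k₁ , x₁∉θ , x₁∉rng , a , e , c
  with HSk-transport (SubstRel-fresh x₁∉θ x₁∉rng w-fresh)
                     (KindA-trans (cons nilˡ) (KindA-sym k₁) (KindA-ren₀ K w-above)) e
... | K° , e° , c° = A₁ , K° , a , e° , KindA-≡αˡ (kpi ≡αt-refl (KindA-sym c°)) c

-- Commutation

aritySize : Arity → ℕ
aritySize o = 1
aritySize (α ⇒ β) = suc (aritySize α + aritySize β)

aritySum : Subst → ℕ
aritySum [] = 0
aritySum ((x , M , α) ∷ θ) = aritySize α + aritySum θ

∈⇒aritySize≤ : ∀ {x M α θ} → (x , M , α) ∈ θ → aritySize α ≤ aritySum θ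
∈⇒aritySize≤ (here refl) = m≤m+n _ _
∈⇒aritySize≤ {θ = (y , N , β) ∷ θ} (there m) = ≤-trans (∈⇒aritySize≤ m) (m≤n+m _ (aritySize β))

HSrc-aritySize≤ : ∀ {θ R N α} → HSrc θ R N α → aritySize α ≤ aritySum θ
HSrc-aritySize≤ (rc-var m) = ∈⇒aritySize≤ m
HSrc-aritySize≤ (rc-app {α' = α'} d e f) =
  ≤-trans (≤-trans (m≤n+m _ (aritySize α')) (n≤1+n _)) (HSrc-aritySize≤ d)
HSrc-aritySize≤ (rc-α r d e) = HSrc-aritySize≤ d

HSrc-domain-aritySize< : ∀ {θ R N α' α} → HSrc θ R N (α' ⇒ α) → aritySize α' < aritySum θ
HSrc-domain-aritySize< {α' = α'} d = ≤-trans (s≤s (m≤m+n (aritySize α') _)) (HSrc-aritySize≤ d)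

SubstitutedBy-InDom : ∀ {σ τ ρ y} → IsSubstitutedBy σ τ ρ → InDom y ρ → InDom y τ
SubstitutedBy-InDom ((refl , _) ∷ p) (here refl) = here refl
SubstitutedBy-InDom (_ ∷ p) (there i) = there (SubstitutedBy-InDom p i)

SubstitutedBy-∈ : ∀ {σ τ ρ y N β} → IsSubstitutedBy σ τ ρ → (y , N , β) ∈ τ →
                  ∃[ N' ] ((y , N' , β) ∈ ρ × HS σ N N')
SubstitutedBy-∈ ((refl , refl , d) ∷ p) (here refl) = _ , here refl , d
SubstitutedBy-∈ (_ ∷ p) (there m) with SubstitutedBy-∈ p m
... | N' , m' , d = N' , there m' , d

SubstitutedBy-aritySum : ∀ {σ τ ρ} → IsSubstitutedBy σ τ ρ → aritySum τ ≡ aritySum ρ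
SubstitutedBy-aritySum [] = refl
SubstitutedBy-aritySum ((refl , refl , d) ∷ p) = cong (_ +_) (SubstitutedBy-aritySum p)

AvoidsDom : Subst → Can → Set
AvoidsDom θ M = ∀ y → InDom y θ → ¬ FreeC y M

mutual
  HS-id : ∀ n {θ M} → sizeC M < n → AvoidsDom θ M → ∃[ N ] (HS θ M N × M ≡αc N)
  HS-id (suc n) {M = at R} sz avoid with HSr-id n {R = R} (≤-pred sz) (λ y i → avoid y i ∘ at)
  ... | R' , d , c = at R' , hs-r d , at c
  HS-id (suc n) {θ} {lam x B} sz avoid
    with HS-id n {θ} {renC x w B} (subst (_< n) (CanA-size ren-B) (≤-pred sz)) avoid-ren
    where
    w : Var
    w = fresh θ (maxC B)
    ren-B : CanA ((x , w) ∷ []) B (renC x w B)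
    ren-B = CanA-ren₀ B (<fresh θ _)
    avoid-ren : AvoidsDom θ (renC x w B)
    avoid-ren y i f with FreeC-transport (CanA-sym ren-B) f
    ... | u , g , vhere = maxS<⇒¬InDom (maxS<fresh θ _) i
    ... | u , g , vthere _ y≢x v with VarRel-[] v
    ... | refl = avoid y i (lam y≢x g)
  ... | N₁ , d , c =
    lam (fresh θ (maxC B)) N₁ ,
    hs-α (lam (CanA-ren₀ B (<fresh θ _))) (hs-lam-fresh (maxS<fresh θ _) d) ≡αc-refl ,
    lam (CanA-≡αʳ (CanA-ren₀ B (<fresh θ _)) c)

  HSr-id : ∀ n {θ R} → sizeA R < n → (∀ y → InDom y θ → ¬ FreeA y R) →
           ∃[ R' ] (HSr θ R R' × R ≡αr R')
  HSr-id (suc n) {R = con c} sz avoid = con c , r-con , con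
  HSr-id (suc n) {R = var x} sz avoid = var x , r-var (λ i → avoid x i var) , ≡αr-refl
  HSr-id (suc n) {R = app R M} sz avoid
    with HSr-id n {R = R} (m+n≤o⇒m≤o (suc (sizeA R)) (≤-pred sz)) (λ y i → avoid y i ∘ appl)
       | HS-id n {M = M} (≤-trans (s≤s (m≤n+m _ _)) (≤-pred sz)) (λ y i → avoid y i ∘ appr)
  ... | R' , d , c | M' , e , c' = app R' M' , r-app d e , app c c'

-- The hypotheses of the theorem, with σ, τ, ρ for θ₁, θ₂, θ₃.
record Compatible (σ τ ρ : Subst) : Set where
  field
    dom-disjoint : ∀ y → InDom y τ → ¬ InDom y σ
    dom-not-free : ∀ y → InDom y τ → NotFreeInRng y σ
    substituted  : IsSubstitutedBy σ τ ρ
open Compatible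

Compatible-single : ∀ {σ w P P' α} → maxS σ < w → HS σ P P' →
                    Compatible σ ((w , P , α) ∷ []) ((w , P' , α) ∷ [])
dom-disjoint (Compatible-single w-fresh d) y (here refl) = maxS<⇒¬InDom w-fresh
dom-not-free (Compatible-single w-fresh d) y (here refl) = maxS<⇒NotFreeInRng w-fresh
substituted (Compatible-single w-fresh d) = (refl , refl , d) ∷ []

¬HSrc-both : ∀ {σ τ ρ} → Compatible σ τ ρ → ∀ R {N N' α β} →
             HSrc σ R N α → HSrc τ R N' β → ⊥
¬HSrc-both C (con c) d d' = ¬HSrc-con d
¬HSrc-both C (var x) d d' with HSrc-var-inv d | HSrc-var-inv d'
... | _ , m , _ | _ , m' , _ = dom-disjoint C x (∈⇒InDom m') (∈⇒InDom m)
¬HSrc-both C (app R M) d d' with HSrc-app-inv d | HSrc-app-inv d'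
... | _ , _ , _ , _ , _ , g , _ | _ , _ , _ , _ , _ , g' , _ = ¬HSrc-both C R g g'

measure : Subst → Subst → ℕ
measure σ τ = aritySum σ + aritySum τ

measure-redexˡ : ∀ {σ τ α} → aritySize α < aritySum τ → aritySum σ + aritySize α < measure σ τ
measure-redexˡ {σ} = +-monoʳ-< (aritySum σ)

measure-redexʳ : ∀ {σ τ ρ α} → IsSubstitutedBy σ τ ρ → aritySize α < aritySum σ →
                 aritySum ρ + aritySize α < measure σ τ
measure-redexʳ {σ} {τ} s h rewrite sym (SubstitutedBy-aritySum s) =
  subst (_<_ _) (+-comm (aritySum τ) (aritySum σ)) (measure-redexˡ {τ} {σ} h)

fresh₃ : Subst → Subst → Subst → ℕ → Var
fresh₃ σ τ ρ k = fresh σ (maxS τ ⊔ (maxS ρ ⊔ k))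

maxS₁<fresh₃ : ∀ σ τ ρ k → maxS σ < fresh₃ σ τ ρ k
maxS₁<fresh₃ σ τ ρ k = maxS<fresh σ _

maxS₂<fresh₃ : ∀ σ τ ρ k → maxS τ < fresh₃ σ τ ρ k
maxS₂<fresh₃ σ τ ρ k = ≤-<-trans (m≤m⊔n (maxS τ) _) (<fresh σ _)

maxS₃<fresh₃ : ∀ σ τ ρ k → maxS ρ < fresh₃ σ τ ρ k
maxS₃<fresh₃ σ τ ρ k = ≤-<-trans (≤-trans (m≤m⊔n (maxS ρ) k) (m≤n⊔m (maxS τ) _)) (<fresh σ _)

<fresh₃ : ∀ σ τ ρ k → k < fresh₃ σ τ ρ k
<fresh₃ σ τ ρ k = ≤-<-trans (≤-trans (m≤n⊔m (maxS ρ) k) (m≤n⊔m (maxS τ) _)) (<fresh σ _)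

suc+≤⇒<ˡ : ∀ {a b n} → suc (a + b) ≤ n → a < n
suc+≤⇒<ˡ {a} = m+n≤o⇒m≤o (suc a)

suc+≤⇒<ʳ : ∀ {a b n} → suc (a + b) ≤ n → b < n
suc+≤⇒<ʳ {a} {b} = ≤-trans (s≤s (m≤n+m b a))

-- k and n are fuel for a lexicographic induction on the measure and on the
-- size of the phrase.
mutual
  HS-commute : ∀ k n {σ τ ρ} → Compatible σ τ ρ → measure σ τ < k →
               ∀ {E E₁ E₂} → sizeC E < n → HS σ E E₁ → HS τ E E₂ →
               ∃[ W ] (HS σ E₂ W × HS ρ E₁ W)
  HS-commute k (suc n) C mk {at R} sz d₁ d₂ = HS-at-commute k n C mk (≤-pred sz) d₁ d₂
  HS-commute k (suc n) {σ} {τ} {ρ} C mk {lam x B} sz d₁ d₂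
    with HS-lam-inv-fresh d₁ (maxS₁<fresh₃ σ τ ρ _) (<fresh₃ σ τ ρ _)
       | HS-lam-inv-fresh d₂ (maxS₂<fresh₃ σ τ ρ _) (<fresh₃ σ τ ρ _)
  ... | C₁ , e₁ , c₁ | C₂ , e₂ , c₂
    with HS-commute k n C mk size-B° e₁ e₂
    where
    size-B° : sizeC (renC x (fresh₃ σ τ ρ (maxC B)) B) < n
    size-B° = subst (_< n) (CanA-size (CanA-ren₀ B (<fresh₃ σ τ ρ _))) (≤-pred sz)
  ... | V , v₁ , v₂ =
    lam (fresh₃ σ τ ρ (maxC B)) V ,
    HS-≡αˡ c₂ (hs-lam-fresh (maxS₁<fresh₃ σ τ ρ _) v₁) ,
    HS-≡αˡ c₁ (hs-lam-fresh (maxS₃<fresh₃ σ τ ρ _) v₂)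

  HS-at-commute : ∀ k n {σ τ ρ} → Compatible σ τ ρ → measure σ τ < k →
                  ∀ {R E₁ E₂} → sizeA R < n → HS σ (at R) E₁ → HS τ (at R) E₂ →
                  ∃[ W ] (HS σ E₂ W × HS ρ E₁ W)
  HS-at-commute k n C mk {R} sz d₁ d₂ with HS-at-inv d₁ | HS-at-inv d₂
  ... | inj₁ (_ , a₁ , c₁) | inj₁ (_ , a₂ , c₂) with HSr-commute k n C mk sz a₁ a₂
  ...   | W , b₁ , b₂ = at W , HS-≡αˡ c₂ (hs-r b₁) , HS-≡αˡ c₁ (hs-r b₂)
  HS-at-commute k n C mk sz d₁ d₂
      | inj₁ (_ , a₁ , c₁) | inj₂ (_ , a₂) with HSr-HSrc-commute k n C mk sz a₁ a₂
  ...   | W , b₁ , b₂ = W , b₁ , HS-≡αˡ c₁ (hs-rc b₂)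
  HS-at-commute k n C mk sz d₁ d₂
      | inj₂ (_ , a₁) | inj₁ (_ , a₂ , c₂) with HSrc-HSr-commute k n C mk sz a₁ a₂
  ...   | W , b₁ , b₂ = W , HS-≡αˡ c₂ (hs-rc b₁) , b₂
  HS-at-commute k n C mk {R} sz d₁ d₂
      | inj₂ (_ , a₁) | inj₂ (_ , a₂) = ⊥-elim (¬HSrc-both C R a₁ a₂)

  HSr-commute : ∀ k n {σ τ ρ} → Compatible σ τ ρ → measure σ τ < k →
                ∀ {R R₁ R₂} → sizeA R < n → HSr σ R R₁ → HSr τ R R₂ →
                ∃[ W ] (HSr σ R₂ W × HSr ρ R₁ W)
  HSr-commute k (suc n) C mk {con c} sz d₁ d₂ =
    con c , HSr-≡αˡ (HSr-con-inv d₂) r-con , HSr-≡αˡ (HSr-con-inv d₁) r-con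
  HSr-commute k (suc n) C mk {var x} sz d₁ d₂ with HSr-var-inv d₁ | HSr-var-inv d₂
  ... | x∉σ , c₁ | x∉τ , c₂ =
    var x , HSr-≡αˡ c₂ (r-var x∉σ) , HSr-≡αˡ c₁ (r-var (x∉τ ∘ SubstitutedBy-InDom (substituted C)))
  HSr-commute k (suc n) C mk {app R M} sz d₁ d₂ with HSr-app-inv d₁ | HSr-app-inv d₂
  ... | _ , _ , a₁ , b₁ , c₁ | _ , _ , a₂ , b₂ , c₂
    with HSr-commute k n C mk (suc+≤⇒<ˡ (≤-pred sz)) a₁ a₂
       | HS-commute k n C mk (suc+≤⇒<ʳ {sizeA R} (≤-pred sz)) b₁ b₂
  ... | U , u₁ , u₂ | V , v₁ , v₂ =
    app U V , HSr-≡αˡ c₂ (r-app u₁ v₁) , HSr-≡αˡ c₁ (r-app u₂ v₂)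

  HSr-HSrc-commute : ∀ k n {σ τ ρ} → Compatible σ τ ρ → measure σ τ < k →
                     ∀ {R R₁ N₂ β} → sizeA R < n → HSr σ R R₁ → HSrc τ R N₂ β →
                     ∃[ X ] (HS σ N₂ X × HSrc ρ R₁ X β)
  HSr-HSrc-commute k (suc n) C mk {con c} sz d₁ d₂ = ⊥-elim (¬HSrc-con d₂)
  HSr-HSrc-commute k (suc n) C mk {var y} sz d₁ d₂ with HSr-var-inv d₁ | HSrc-var-inv d₂
  ... | _ , c₁ | N , m , e with SubstitutedBy-∈ (substituted C) m
  ... | N' , m' , d = N' , HS-≡αˡ e d , HSrc-≡αˡ c₁ (rc-var m')
  HSr-HSrc-commute k (suc n) {σ} {τ} C mk {app R M} sz d₁ d₂ with HSr-app-inv d₁ | HSrc-app-inv d₂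
  ... | _ , _ , a₁ , b₁ , c₁ | _ , _ , _ , _ , _ , a₂ , b₂ , f₂ , c₂
    with HSr-HSrc-commute k n C mk (suc+≤⇒<ˡ (≤-pred sz)) a₁ a₂
       | HS-commute k n C mk (suc+≤⇒<ʳ {sizeA R} (≤-pred sz)) b₁ b₂
  ... | L , l₁ , l₂ | P' , p₁ , p₂
    with redex-commute k (measure-redexˡ {σ} {τ} (HSrc-domain-aritySize< a₂)) mk l₁ p₁ f₂
  ... | _ , _ , W , L≡ , q , r =
    W , HS-≡αˡ c₂ r , HSrc-≡αˡ c₁ (rc-app (rc-α ≡αr-refl l₂ L≡) p₂ q)

  HSrc-HSr-commute : ∀ k n {σ τ ρ} → Compatible σ τ ρ → measure σ τ < k →
                     ∀ {R N₁ R₂ β} → sizeA R < n → HSrc σ R N₁ β → HSr τ R R₂ →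
                     ∃[ X ] (HSrc σ R₂ X β × HS ρ N₁ X)
  HSrc-HSr-commute k (suc n) C mk {con c} sz d₁ d₂ = ⊥-elim (¬HSrc-con d₁)
  HSrc-HSr-commute k (suc n) {ρ = ρ} C mk {var x} sz d₁ d₂ with HSrc-var-inv d₁ | HSr-var-inv d₂
  ... | M , m , e | _ , c₂ with HS-id (suc (sizeC M)) {ρ} {M} ≤-refl avoids
    where
    avoids : AvoidsDom ρ M
    avoids y i = dom-not-free C y (SubstitutedBy-InDom (substituted C) i) m
  ... | N , d , e' = N , rc-α (≡αr-sym c₂) (rc-var m) e' , HS-≡αˡ e d
  HSrc-HSr-commute k (suc n) C mk {app R M} sz d₁ d₂ with HSrc-app-inv d₁ | HSr-app-inv d₂
  ... | _ , _ , _ , _ , _ , a₁ , b₁ , f₁ , c₁ | _ , _ , a₂ , b₂ , c₂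
    with HSrc-HSr-commute k n C mk (suc+≤⇒<ˡ (≤-pred sz)) a₁ a₂
       | HS-commute k n C mk (suc+≤⇒<ʳ {sizeA R} (≤-pred sz)) b₁ b₂
  ... | L , l₁ , l₂ | P' , p₁ , p₂
    with redex-commute k (measure-redexʳ (substituted C) (HSrc-domain-aritySize< a₁)) mk l₂ p₂ f₁
  ... | _ , _ , W , L≡ , q , r =
    W , HSrc-≡αˡ c₂ (rc-app (rc-α ≡αr-refl l₁ L≡) p₁ q) , HS-≡αˡ c₁ r

  -- The non-structural step: a recursive call on a renaming of Q at a smaller measure.
  redex-commute : ∀ k {m φ z Q L P P' α N} → aritySum φ + aritySize α < m → m < k →
                  HS φ (lam z Q) L → HS φ P P' → HS ((z , P , α) ∷ []) Q N →
                  ∃[ w ] ∃[ Q° ] ∃[ W ] (L ≡αc lam w Q° × HS ((w , P' , α) ∷ []) Q° W × HS φ N W)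
  redex-commute (suc k) {φ = φ} {z} {Q} {P = P} {α = α} small m<k l p f
    with HS-lam-inv-fresh l (maxS<fresh φ _) (<fresh φ _)
       | HS-transport (SubstRel-single {α = α} {Γ' = []} (≡αc-refl {P})) (CanA-ren₀ Q (<fresh φ _)) f
  ... | Q° , q , lam≡ | N° , f° , c
    with HS-commute k (suc (sizeC (renC z w Q))) (Compatible-single (maxS<fresh φ _) p) measure< ≤-refl q f°
    where
    w : Var
    w = fresh φ (maxC Q)
    measure< : measure φ ((w , P , α) ∷ []) < k
    measure< = subst (λ a → aritySum φ + a < k) (sym (+-identityʳ _)) (<-≤-trans small (≤-pred m<k))
  ... | W , w₁ , w₂ = fresh φ (maxC Q) , Q° , W , ≡αc-sym lam≡ , w₂ , hs-α c w₁ ≡αc-refl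

HSp-commute : ∀ k n {σ τ ρ} → Compatible σ τ ρ → measure σ τ < k →
              ∀ {E E₁ E₂} → sizeP E < n → HSp σ E E₁ → HSp τ E E₂ →
              ∃[ W ] (HSp σ E₂ W × HSp ρ E₁ W)
HSp-commute k (suc n) C mk {tcon a} sz d₁ d₂ =
  tcon a , HSp-≡αˡ (HSp-con-inv d₂) p-con , HSp-≡αˡ (HSp-con-inv d₁) p-con
HSp-commute k (suc n) C mk {tapp P M} sz d₁ d₂ with HSp-app-inv d₁ | HSp-app-inv d₂
... | _ , _ , a₁ , b₁ , c₁ | _ , _ , a₂ , b₂ , c₂
  with HSp-commute k n C mk (suc+≤⇒<ˡ (≤-pred sz)) a₁ a₂
     | HS-commute k n C mk (suc+≤⇒<ʳ {sizeP P} (≤-pred sz)) b₁ b₂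
... | U , u₁ , u₂ | V , v₁ , v₂ =
  tapp U V , HSp-≡αˡ c₂ (p-app u₁ v₁) , HSp-≡αˡ c₁ (p-app u₂ v₂)

HSt-commute : ∀ k n {σ τ ρ} → Compatible σ τ ρ → measure σ τ < k →
              ∀ {E E₁ E₂} → sizeT E < n → HSt σ E E₁ → HSt τ E E₂ →
              ∃[ W ] (HSt σ E₂ W × HSt ρ E₁ W)
HSt-commute k (suc n) C mk {base P} sz d₁ d₂ with HSt-base-inv d₁ | HSt-base-inv d₂
... | _ , a₁ , c₁ | _ , a₂ , c₂ with HSp-commute k n C mk (≤-pred sz) a₁ a₂
... | U , u₁ , u₂ = base U , HSt-≡αˡ c₂ (t-base u₁) , HSt-≡αˡ c₁ (t-base u₂)
HSt-commute k (suc n) {σ} {τ} {ρ} C mk {pi x A B} sz d₁ d₂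
  with HSt-pi-inv-fresh d₁ (maxS₁<fresh₃ σ τ ρ _) (<fresh₃ σ τ ρ _)
     | HSt-pi-inv-fresh d₂ (maxS₂<fresh₃ σ τ ρ _) (<fresh₃ σ τ ρ _)
... | _ , _ , a₁ , b₁ , c₁ | _ , _ , a₂ , b₂ , c₂
  with HSt-commute k n C mk (suc+≤⇒<ˡ (≤-pred sz)) a₁ a₂
     | HSt-commute k n C mk size-B° b₁ b₂
  where
  size-B° : sizeT (renT x (fresh₃ σ τ ρ (maxT B)) B) < n
  size-B° = subst (_< n) (TyA-size (TyA-ren₀ B (<fresh₃ σ τ ρ _))) (suc+≤⇒<ʳ {sizeT A} (≤-pred sz))
... | U , u₁ , u₂ | V , v₁ , v₂ =
  pi (fresh₃ σ τ ρ (maxT B)) U V ,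
  HSt-≡αˡ c₂ (t-pi-fresh (maxS₁<fresh₃ σ τ ρ _) u₁ v₁) ,
  HSt-≡αˡ c₁ (t-pi-fresh (maxS₃<fresh₃ σ τ ρ _) u₂ v₂)

HSk-commute : ∀ k n {σ τ ρ} → Compatible σ τ ρ → measure σ τ < k →
              ∀ {E E₁ E₂} → sizeK E < n → HSk σ E E₁ → HSk τ E E₂ →
              ∃[ W ] (HSk σ E₂ W × HSk ρ E₁ W)
HSk-commute k (suc n) C mk {type} sz d₁ d₂ =
  type , HSk-≡αˡ (HSk-type-inv d₂) k-type , HSk-≡αˡ (HSk-type-inv d₁) k-type
HSk-commute k (suc n) {σ} {τ} {ρ} C mk {kpi x A K} sz d₁ d₂
  with HSk-pi-inv-fresh d₁ (maxS₁<fresh₃ σ τ ρ _) (<fresh₃ σ τ ρ _)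
     | HSk-pi-inv-fresh d₂ (maxS₂<fresh₃ σ τ ρ _) (<fresh₃ σ τ ρ _)
... | _ , _ , a₁ , b₁ , c₁ | _ , _ , a₂ , b₂ , c₂
  with HSt-commute k n C mk (suc+≤⇒<ˡ (≤-pred sz)) a₁ a₂
     | HSk-commute k n C mk size-K° b₁ b₂
  where
  size-K° : sizeK (renK x (fresh₃ σ τ ρ (maxK K)) K) < n
  size-K° = subst (_< n) (KindA-size (KindA-ren₀ K (<fresh₃ σ τ ρ _))) (suc+≤⇒<ʳ {sizeT A} (≤-pred sz))
... | U , u₁ , u₂ | V , v₁ , v₂ =
  kpi (fresh₃ σ τ ρ (maxK K)) U V ,
  HSk-≡αˡ c₂ (k-pi-fresh (maxS₁<fresh₃ σ τ ρ _) u₁ v₁) ,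
  HSk-≡αˡ c₁ (k-pi-fresh (maxS₃<fresh₃ σ τ ρ _) u₂ v₂)

theorem2p3 : (θ₁ θ₂ θ₃ : Subst) → IsSubst θ₁ → IsSubst θ₂ →
    (∀ y → InDom y θ₂ → ¬ InDom y θ₁) →
    (∀ y → InDom y θ₂ → NotFreeInRng y θ₁) →
    IsSubstitutedBy θ₁ θ₂ θ₃ →
    (∀ K K₁ K₂ → HSk θ₁ K K₁ → HSk θ₂ K K₂ → ∃[ K' ] (HSk θ₁ K₂ K' × HSk θ₃ K₁ K'))
    × (∀ A A₁ A₂ → HSt θ₁ A A₁ → HSt θ₂ A A₂ → ∃[ A' ] (HSt θ₁ A₂ A' × HSt θ₃ A₁ A'))
    × (∀ M M₁ M₂ → HS θ₁ M M₁ → HS θ₂ M M₂ → ∃[ M' ] (HS θ₁ M₂ M' × HS θ₃ M₁ M'))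
theorem2p3 θ₁ θ₂ θ₃ _ _ disjoint not-free substituted =
  (λ K _ _ → HSk-commute k (suc (sizeK K)) C ≤-refl ≤-refl) ,
  (λ A _ _ → HSt-commute k (suc (sizeT A)) C ≤-refl ≤-refl) ,
  (λ M _ _ → HS-commute k (suc (sizeC M)) C ≤-refl ≤-refl)
  where
  k : ℕ
  k = suc (measure θ₁ θ₂)
  C : Compatible θ₁ θ₂ θ₃
  C = record { dom-disjoint = disjoint ; dom-not-free = not-free ; substituted = substituted }
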